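{- Let $l\ge1$, $e\ge2$ be integers with $l$ dividing $e$, and let ${\bf s}=(0,e/l,2e/l,\ldots,(l-1)e/l)$. Let $n\ge 0$, let ${\boldsymbol{\lambda}}=(\lambda^1,\ldots,\lambda^l)\in\Phi_{e,{\bf s}}(n)$, and suppose $(i_1,\ldots,i_n)\in(\mathbb{Z}/e\mathbb{Z})^n$ satisfies $\widetilde{f}^{e,{\bf s}}_{i_1}\cdots\widetilde{f}^{e,{\bf s}}_{i_n}\,\emptyset={\boldsymbol{\lambda}}$. Then ${\boldsymbol{\mu}}:=(\lambda^l,\lambda^1,\ldots,\lambda^{l-1})\in\Phi_{e,{\bf s}}(n)$ and $$\widetilde{f}^{e,{\bf s}}_{i_1+e/l}\cdots\widetilde{f}^{e,{\bf s}}_{i_n+e/l}\,\emptyset={\boldsymbol{\mu}}.$$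
   Context: An $l$-partition of $n$ is an $l$-tuple ${\boldsymbol{\lambda}}=(\lambda^1,\ldots,\lambda^l)$ of partitions whose sizes sum to $n$; $\emptyset$ denotes the empty $l$-partition. For a multicharge ${\bf s}=(s_1,\ldots,s_l)\in\mathbb{Z}^l$, the Young diagram of ${\boldsymbol{\lambda}}$ is the set of nodes $(a,b,c)$ with $1\le c\le l$, $a\ge1$, $1\le b\le\lambda^c_a$; the content of $(a,b,c)$ is $b-a+s_c$ and its residue is the content modulo $e$. A node is removable if it lies in the diagram and removing it leaves the diagram of an $l$-partition, addable if it does not lie in the diagram and adding it gives the diagram of an $l$-partition. For $i\in\mathbb{Z}/e\mathbb{Z}$, order the addable and removable nodes of residue $i$ by $(a,b,c)\prec_{\bf s}(a',b',c')$ iff either $b-a+s_c<b'-a'+s_{c'}$, or these contents are equal and $c>c'$. Write these nodes in increasing order, encoding addable nodes by $A$ and removable ones by $R$, and delete factors $RA$ as long as possible to get $A^pR^q$; if $p>0$ the node of the rightmost remaining $A$ is the good addable $i$-node. The Kashiwara operator $\widetilde{f}^{e,{\bf s}}_i$ adds the good addable $i$-node to ${\boldsymbol{\lambda}}$, or gives $0$ if there is none ($\widetilde{f}^{e,{\bf s}}_i(0)=0$). $\Phi_{e,{\bf s}}(n)$ (Uglov $l$-partitions) is the set of $l$-partitions of $n$ equal to $\widetilde{f}^{e,{\bf s}}_{i_1}\cdots\widetilde{f}^{e,{\bf s}}_{i_n}\emptyset$ for some residues $i_1,\ldots,i_n$. Indices of Kashiwara operators are read modulo $e$. -}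

module Defs where

open import Data.Bool using (Bool; true; false; if_then_else_; _∧_; _∨_; not)
open import Data.Nat as ℕ using (ℕ; zero; suc; _<ᵇ_; _≡ᵇ_; _≤_)
import Data.Nat.DivMod as NDM
open import Data.Integer as ℤ using (ℤ; +_; _%ℕ_)
open import Data.Fin using (Fin; toℕ)
open import Data.List as List using (List; []; _∷_; _++_; concatMap)
open import Data.Vec as Vec using (Vec; []; _∷_; lookup; updateAt; replicate; allFin; toList)
open import Data.Maybe using (Maybe; just; nothing; _>>=_)
open import Data.Product using (_×_; _,_; ∃)
open import Relation.Binary.PropositionalEquality using (_≡_)

-- A partition is a List ℕ of positive, weakly decreasing parts;
-- an l-partition is a Vec of l partitions (component c ↔ Fin l, 0-based).
Partition : Set
Partition = List ℕ

LPartition : ℕ → Set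
LPartition l = Vec Partition l

emptyLP : (l : ℕ) → LPartition l
emptyLP l = replicate l []

-- Nodes (a , b , c): row a ≥ 1, column b ≥ 1, component c.
record Node (l : ℕ) : Set where
  constructor node
  field
    row  : ℕ
    col  : ℕ
    comp : Fin l
open Node public

-- addable nodes (row , column) of a partition (rows 1-based)
addablesP : Partition → List (ℕ × ℕ)
addablesP p = go nothing 1 p
  where
  ok : Maybe ℕ → ℕ → Bool
  ok nothing  _ = true
  ok (just y) x = x <ᵇ y
  go : Maybe ℕ → ℕ → List ℕ → List (ℕ × ℕ)
  go prev a []       = if ok prev 0 then (a , 1) ∷ [] else []
  go prev a (x ∷ xs) = (if ok prev x then (a , suc x) ∷ [] else []) ++ go (just x) (suc a) xs

removablesP : Partition → List (ℕ × ℕ)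
removablesP p = go 1 p
  where
  nextLess : ℕ → List ℕ → Bool
  nextLess x []      = 0 <ᵇ x
  nextLess x (y ∷ _) = y <ᵇ x
  go : ℕ → List ℕ → List (ℕ × ℕ)
  go a []       = []
  go a (x ∷ xs) = (if nextLess x xs then (a , x) ∷ [] else []) ++ go (suc a) xs

content : {l : ℕ} → Vec ℤ l → Node l → ℤ
content s (node a b c) = (+ b ℤ.- + a) ℤ.+ lookup s c

-- residue of an integer modulo e (e ≥ 2 in the theorem; e = 0 case is a dummy)
resℤ : ℕ → ℤ → ℕ
resℤ zero    x = 0
resℤ (suc k) x = x %ℕ suc k

resℕ : ℕ → ℕ → ℕ
resℕ zero    x = x
resℕ (suc k) x = x NDM.% suc k

data Sign : Set where
  A R : Sign

-- the order ≺_s: smaller content first; equal content: larger component first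
precᵇ : {l : ℕ} → Vec ℤ l → Node l → Node l → Bool
precᵇ s x y = ((content s x ℤ.≤ᵇ content s y) ∧ not (content s y ℤ.≤ᵇ content s x))
            ∨ ((content s x ℤ.≤ᵇ content s y) ∧ (content s y ℤ.≤ᵇ content s x)
               ∧ (toℕ (comp y) <ᵇ toℕ (comp x)))

insertBy : {X : Set} → (X → X → Bool) → X → List X → List X
insertBy lt x []       = x ∷ []
insertBy lt x (y ∷ ys) = if lt x y then x ∷ y ∷ ys else y ∷ insertBy lt x ys

sortBy : {X : Set} → (X → X → Bool) → List X → List X
sortBy lt = List.foldr (insertBy lt) []

-- all addable (A) and removable (R) nodes of residue i (index read modulo e)
iNodes : (e : ℕ) {l : ℕ} → Vec ℤ l → ℕ → LPartition l → List (Sign × Node l)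
iNodes e {l} s i λ′ = collect (toList (allFin l))
  where
  collect : List (Fin l) → List (Sign × Node l)
  collect cs = List.filterᵇ (λ { (_ , x) → resℤ e (content s x) ≡ᵇ resℕ e i })
    (concatMap (λ c → List.map (λ { (a , b) → (A , node a b c) }) (addablesP (lookup λ′ c))
                   ++ List.map (λ { (a , b) → (R , node a b c) }) (removablesP (lookup λ′ c))) cs)

signature : (e : ℕ) {l : ℕ} → Vec ℤ l → ℕ → LPartition l → List (Sign × Node l)
signature e s i λ′ = sortBy (λ x y → precᵇ s (Data.Product.proj₂ x) (Data.Product.proj₂ y)) (iNodes e s i λ′)
  where import Data.Product

-- deleting factors RA as long as possible (stack reduction);
-- the accumulator holds the reduced prefix in reverse order.
reduceRA : {X : Set} → List (Sign × X) → List (Sign × X) → List (Sign × X)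
reduceRA acc []                          = acc
reduceRA ((R , _) ∷ acc) ((A , _) ∷ w)   = reduceRA acc w
reduceRA acc (x ∷ w)                     = reduceRA (x ∷ acc) w

-- first A in a reversed word = rightmost A of the word
firstA : {X : Set} → List (Sign × X) → Maybe X
firstA []            = nothing
firstA ((A , x) ∷ _) = just x
firstA ((R , _) ∷ w) = firstA w

goodAddable : (e : ℕ) {l : ℕ} → Vec ℤ l → ℕ → LPartition l → Maybe (Node l)
goodAddable e s i λ′ = firstA (reduceRA [] (signature e s i λ′))

-- set row a (1-based) of a partition to length b (adding an addable node (a,b))
setRow : ℕ → ℕ → Partition → Partition
setRow zero    b p        = p
setRow (suc zero) b []    = b ∷ []
setRow (suc zero) b (x ∷ xs) = b ∷ xs
setRow (suc (suc a)) b [] = []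
setRow (suc (suc a)) b (x ∷ xs) = x ∷ setRow (suc a) b xs

addNode : {l : ℕ} → Node l → LPartition l → LPartition l
addNode (node a b c) λ′ = updateAt λ′ c (setRow a b)

-- Kashiwara operator f̃_i^{e,s}; 'nothing' plays the role of 0.
kashiwaraF : (e : ℕ) {l : ℕ} → Vec ℤ l → ℕ → Maybe (LPartition l) → Maybe (LPartition l)
kashiwaraF e s i m = m >>= λ λ′ → Data.Maybe.map (λ x → addNode x λ′) (goodAddable e s i λ′)
  where import Data.Maybe

-- f̃_{i_1} ⋯ f̃_{i_n} applied to x (f̃_{i_n} applied first)
applySeq : (e : ℕ) {l : ℕ} → Vec ℤ l → {n : ℕ} → Vec ℕ n → Maybe (LPartition l) → Maybe (LPartition l)
applySeq e s []       x = x
applySeq e s (i ∷ is) x = kashiwaraF e s i (applySeq e s is x)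

-- residues i ∈ ℤ/eℤ represented by Fin e
toRes : {e n : ℕ} → Vec (Fin e) n → Vec ℕ n
toRes = Vec.map toℕ

Φ : (e : ℕ) {l : ℕ} → Vec ℤ l → ℕ → LPartition l → Set
Φ e {l} s n λ′ = ∃ λ (is : Vec (Fin e) n) → applySeq e s (toRes is) (just (emptyLP l)) ≡ just λ′

-- e / l (l ≥ 1 in the theorem; l = 0 is a dummy case)
divℕ : ℕ → ℕ → ℕ
divℕ e zero    = 0
divℕ e (suc k) = e NDM./ suc k

uglovCharge : (e l : ℕ) → Vec ℤ l
uglovCharge e l = Vec.map (λ c → + (toℕ c ℕ.* divℕ e l)) (allFin l)

rotate : {A : Set} {l : ℕ} → Vec A l → Vec A l
rotate {l = zero}  v = v
rotate {l = suc k} v = Vec.last v ∷ Vec.init v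

-- shift every index by e/l (indices read modulo e)
shiftSeq : (e l : ℕ) {n : ℕ} → Vec (Fin e) n → Vec ℕ n
shiftSeq e l is = Vec.map (λ i → toℕ i ℕ.+ divℕ e l) is

-- Let ρ shift components cyclically, c ↦ c + 1 with the last component sent to 0. As
-- s_{c+1} = s_c + e/l and s_0 + e = s_{l-1} + e/l, ρ raises every content by e/l, except on the
-- last component where it raises it by e/l − e; so residues shift by e/l. Contents of nodes of
-- equal residue differ by multiples of e, and ρ preserves ≺_s among them: when exactly one of two
-- nodes lies on the last component, the loss of e in its content is exactly compensated by the
-- change of the component tie-break. Hence ρ maps the i-signature of λ term by term onto the
-- (i + e/l)-signature of ρ λ (the enumeration order of components is irrelevant, since nodes on
-- different components never tie), good nodes to good nodes, and f̃_{i+e/l} ∘ ρ = ρ ∘ f̃_i.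
module Submission where

open import Defs

open import Data.Bool using (Bool; true; false; not; _∧_; _∨_; T)
open import Data.Bool.Properties using (∧-assoc)
open import Data.Empty using (⊥-elim)
open import Data.Fin using (Fin; zero; suc; toℕ; fromℕ; inject₁; fromℕ<)
open import Data.Fin.Properties
  using (toℕ<n; toℕ-fromℕ; toℕ-inject₁; toℕ-fromℕ<; fromℕ≢inject₁; toℕ-injective)
open import Data.Integer as ℤ using (ℤ; +_; -_; _+_; _-_; _*_; _%ℕ_; _/ℕ_; 0ℤ)
import Data.Integer.Properties as ℤ
open import Data.Integer.DivMod using (a≡a%ℕn+[a/ℕn]*n; n%ℕd<d)
open import Data.Integer.Tactic.RingSolver using (solve-∀)
open import Data.List as List using (List; []; _∷_; _++_; map; foldr; concatMap; filterᵇ)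
import Data.List.Properties as List
open import Data.List.Relation.Unary.All as All using (All; []; _∷_)
import Data.List.Relation.Unary.All.Properties as All
open import Data.Maybe as Maybe using (Maybe; just; nothing)
open import Data.Nat as ℕ using (ℕ; zero; suc; _≤_)
import Data.Nat.Properties as ℕ
import Data.Nat.DivMod as ℕ
open import Data.Nat.Divisibility using (_∣_)
open import Data.Product using (_×_; _,_; proj₂; map₂)
open import Data.Product.Relation.Binary.Lex.Strict using (×-Lex; ×-decidable; ×-transitive; ×-asymmetric)
open import Data.Sum using (_⊎_; inj₁; inj₂; [_,_])
open import Data.Vec as Vec using (Vec; []; _∷_; lookup; updateAt; replicate; allFin; toList)
import Data.Vec.Properties as Vec
open import Function using (_∘_; id; case_of_)
open import Function.Bundles using (_⇔_; mk⇔)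
import Function.Properties.Equivalence as ⇔
open import Function.Related.Propositional using (module EquationalReasoning; equivalence)
open import Relation.Binary.Definitions using (Decidable; Transitive; Asymmetric; tri<; tri≈; tri>)
open import Relation.Binary.PropositionalEquality
  using (_≡_; _≢_; refl; sym; trans; cong; cong₂; subst; subst₂; resp₂; isEquivalence; module ≡-Reasoning)
open import Relation.Nullary using (does; ¬_; Dec; yes; no)
open import Relation.Nullary.Decidable using (T?; _×-dec_; ¬?; does-⇔; dec-true)

open import Algebra.Properties.AbelianGroup ℤ.+-0-abelianGroup using (quasigroup)
open import Algebra.Properties.CommutativeSemigroup ℤ.+-commutativeSemigroup using (xy∙z≈xz∙y)
open import Algebra.Properties.Quasigroup quasigroup using (cancelʳ)

-- Integers modulo e

private
  [i+k]-k≡i : ∀ i k → i + k - k ≡ i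
  [i+k]-k≡i = solve-∀

+-cancelʳ-≤ : ∀ k {i j} → i + k ℤ.≤ j + k → i ℤ.≤ j
+-cancelʳ-≤ k {i} {j} le = subst₂ ℤ._≤_ ([i+k]-k≡i i k) ([i+k]-k≡i j k) (ℤ.+-monoˡ-≤ (- k) le)

+-cancelʳ-< : ∀ k {i j} → i + k ℤ.< j + k → i ℤ.< j
+-cancelʳ-< k {i} {j} lt = subst₂ ℤ._<_ ([i+k]-k≡i i k) ([i+k]-k≡i j k) (ℤ.+-monoˡ-< (- k) lt)

+-cancelˡ-< : ∀ k {i j} → k + i ℤ.< k + j → i ℤ.< j
+-cancelˡ-< k {i} {j} lt = +-cancelʳ-< k (subst₂ ℤ._<_ (ℤ.+-comm k i) (ℤ.+-comm k j) lt)

module _ (e : ℕ) .{{_ : ℕ.NonZero e}} where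

  quotient-≤ : ∀ r r′ q q′ → r′ ℕ.< e → + r + q * + e ≡ + r′ + q′ * + e → q ℤ.≤ q′
  quotient-≤ r r′ q q′ r′<e eq =
    subst (q ℤ.≤_) (ℤ.pred-suc q′) (ℤ.i<j⇒i≤pred[j] (ℤ.*-cancelʳ-<-nonNeg {i = q} {j = ℤ.suc q′} (+ e) (begin-strict
      q * + e            ≤⟨ ℤ.i≤j+i _ (+ r) ⟩
      + r + q * + e      ≡⟨ eq ⟩
      + r′ + q′ * + e    <⟨ ℤ.+-monoˡ-< (q′ * + e) (ℤ.+<+ r′<e) ⟩
      + e + q′ * + e     ≡⟨ ℤ.suc-* q′ (+ e) ⟨
      ℤ.suc q′ * + e     ∎)))
    where open ℤ.≤-Reasoning

  %ℕ-unique : ∀ a r q → r ℕ.< e → a ≡ + r + q * + e → a %ℕ e ≡ r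
  %ℕ-unique a r q r<e a≡r+qe = ℤ.+-injective (cancelʳ (q * + e) (+ (a %ℕ e)) (+ r) (begin
    + (a %ℕ e) + q * + e        ≡⟨ cong (λ q′ → + (a %ℕ e) + q′ * + e) q≡a/e ⟩
    + (a %ℕ e) + (a /ℕ e) * + e ≡⟨ a≡ ⟨
    a                           ≡⟨ a≡r+qe ⟩
    + r + q * + e               ∎))
    where
    open ≡-Reasoning
    a≡ : a ≡ + (a %ℕ e) + (a /ℕ e) * + e
    a≡ = a≡a%ℕn+[a/ℕn]*n a e
    q≡a/e : q ≡ a /ℕ e
    q≡a/e = ℤ.≤-antisym (quotient-≤ r (a %ℕ e) q (a /ℕ e) (n%ℕd<d a e) (trans (sym a≡r+qe) a≡))
                        (quotient-≤ (a %ℕ e) r (a /ℕ e) q r<e (trans (sym a≡) a≡r+qe))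

  [i+n]%ℕe≡[i%ℕe+n]%e : ∀ a n → (a + + n) %ℕ e ≡ (a %ℕ e ℕ.+ n) ℕ.% e
  [i+n]%ℕe≡[i%ℕe+n]%e a n = %ℕ-unique (a + + n) (m ℕ.% e) (+ (m ℕ./ e) + a /ℕ e) (ℕ.m%n<n m e) (begin
    a + + n                                            ≡⟨ cong (_+ + n) (a≡a%ℕn+[a/ℕn]*n a e) ⟩
    + (a %ℕ e) + a /ℕ e * + e + + n                    ≡⟨ regroup (+ (a %ℕ e)) (+ n) (a /ℕ e) (+ e) ⟩
    + m + a /ℕ e * + e                                 ≡⟨ cong (λ x → + x + a /ℕ e * + e) (ℕ.m≡m%n+[m/n]*n m e) ⟩
    + (m ℕ.% e ℕ.+ m ℕ./ e ℕ.* e) + a /ℕ e * + e       ≡⟨ cong (_+ a /ℕ e * + e) (lift (m ℕ.% e) (m ℕ./ e)) ⟩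
    + (m ℕ.% e) + + (m ℕ./ e) * + e + a /ℕ e * + e     ≡⟨ regroup′ (+ (m ℕ.% e)) (+ (m ℕ./ e)) (a /ℕ e) (+ e) ⟩
    + (m ℕ.% e) + (+ (m ℕ./ e) + a /ℕ e) * + e         ∎)
    where
    open ≡-Reasoning
    m = a %ℕ e ℕ.+ n
    regroup : ∀ r n q e → r + q * e + n ≡ r + n + q * e
    regroup = solve-∀
    lift : ∀ r q → + (r ℕ.+ q ℕ.* e) ≡ + r + + q * + e
    lift r q = trans (ℤ.pos-+ r (q ℕ.* e)) (cong (λ x → + r + x) (ℤ.pos-* q e))
    regroup′ : ∀ r q q′ e → r + q * e + q′ * e ≡ r + (q + q′) * e
    regroup′ = solve-∀

  [i+e]%ℕe≡i%ℕe : ∀ a → (a + + e) %ℕ e ≡ a %ℕ e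
  [i+e]%ℕe≡i%ℕe a = begin
    (a + + e) %ℕ e          ≡⟨ [i+n]%ℕe≡[i%ℕe+n]%e a e ⟩
    (a %ℕ e ℕ.+ e) ℕ.% e    ≡⟨ ℕ.[m+n]%n≡m%n (a %ℕ e) e ⟩
    a %ℕ e ℕ.% e            ≡⟨ ℕ.m<n⇒m%n≡m (n%ℕd<d a e) ⟩
    a %ℕ e                  ∎
    where open ≡-Reasoning

  i<i+e : ∀ i → i ℤ.< i + + e
  i<i+e i = subst (ℤ._< i + + e) (ℤ.+-identityʳ i) (ℤ.+-monoʳ-< i (ℤ.+<+ (ℕ.>-nonZero⁻¹ e)))

  ≡-mod∧<+e⇒≤ : ∀ {a b} → a %ℕ e ≡ b %ℕ e → a ℤ.< b + + e → a ℤ.≤ b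
  ≡-mod∧<+e⇒≤ {a} {b} a≡b a<b+e = begin
    a                    ≡⟨ a≡ ⟩
    + r + a /ℕ e * + e   ≤⟨ ℤ.+-monoʳ-≤ (+ r) (ℤ.*-monoʳ-≤-nonNeg (+ e) qa≤qb) ⟩
    + r + b /ℕ e * + e   ≡⟨ a≡a%ℕn+[a/ℕn]*n b e ⟨
    b                    ∎
    where
    open ℤ.≤-Reasoning
    r = b %ℕ e
    a≡ : a ≡ + r + a /ℕ e * + e
    a≡ = trans (a≡a%ℕn+[a/ℕn]*n a e) (cong (λ x → + x + a /ℕ e * + e) a≡b)
    b+e≡ : b + + e ≡ + r + ℤ.suc (b /ℕ e) * + e
    b+e≡ = trans (cong (_+ + e) (a≡a%ℕn+[a/ℕn]*n b e)) (shift (+ r) (b /ℕ e) (+ e))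
      where shift : ∀ r q e → r + q * e + e ≡ r + (ℤ.1ℤ + q) * e
            shift = solve-∀
    qa≤qb : a /ℕ e ℤ.≤ b /ℕ e
    qa≤qb = subst (a /ℕ e ℤ.≤_) (ℤ.pred-suc (b /ℕ e)) (ℤ.i<j⇒i≤pred[j]
              (ℤ.*-cancelʳ-<-nonNeg {i = a /ℕ e} {j = ℤ.suc (b /ℕ e)} (+ e)
                (+-cancelˡ-< (+ r) (subst₂ ℤ._<_ a≡ b+e≡ a<b+e))))

  ≤⇔<+e : ∀ {a b} → a %ℕ e ≡ b %ℕ e → a ℤ.≤ b ⇔ a ℤ.< b + + e
  ≤⇔<+e {b = b} a≡b = mk⇔ (λ a≤b → ℤ.≤-<-trans a≤b (i<i+e b)) (≡-mod∧<+e⇒≤ a≡b)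

  <⇔+e≤ : ∀ {a b} → a %ℕ e ≡ b %ℕ e → a ℤ.< b ⇔ a + + e ℤ.≤ b
  <⇔+e≤ {a} a≡b = mk⇔
    (λ a<b → ℤ.≮⇒≥ (λ b<a+e → ℤ.<⇒≱ a<b (≡-mod∧<+e⇒≤ (sym a≡b) b<a+e)))
    (ℤ.<-≤-trans (i<i+e a))

≤-shift-⇔ : ∀ {a b a′ b′} p q → a + p ≡ a′ + q → b + p ≡ b′ + q → a ℤ.≤ b ⇔ a′ ℤ.≤ b′
≤-shift-⇔ p q ha hb = mk⇔
  (λ a≤b → +-cancelʳ-≤ q (subst₂ ℤ._≤_ ha hb (ℤ.+-monoˡ-≤ p a≤b)))
  (λ a′≤b′ → +-cancelʳ-≤ p (subst₂ ℤ._≤_ (sym ha) (sym hb) (ℤ.+-monoˡ-≤ q a′≤b′)))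

<-shift-⇔ : ∀ {a b a′ b′} p q → a + p ≡ a′ + q → b + p ≡ b′ + q → a ℤ.< b ⇔ a′ ℤ.< b′
<-shift-⇔ p q ha hb = mk⇔
  (λ a<b → +-cancelʳ-< q (subst₂ ℤ._<_ ha hb (ℤ.+-monoˡ-< p a<b)))
  (λ a′<b′ → +-cancelʳ-< p (subst₂ ℤ._<_ (sym ha) (sym hb) (ℤ.+-monoˡ-< q a′<b′)))

m%n≡o%n⇔[m+d]%n≡[o+d]%n : ∀ m o d n .{{_ : ℕ.NonZero n}} → m ℕ.% n ≡ o ℕ.% n ⇔ (m ℕ.+ d) ℕ.% n ≡ (o ℕ.+ d) ℕ.% n
m%n≡o%n⇔[m+d]%n≡[o+d]%n m o d n = mk⇔ (add d) (λ eq → trans (sym (cancel m)) (trans (add (d ℕ.* n ℕ.∸ d) eq) (cancel o)))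
  where
  add : ∀ t {m o} → m ℕ.% n ≡ o ℕ.% n → (m ℕ.+ t) ℕ.% n ≡ (o ℕ.+ t) ℕ.% n
  add t {m} {o} eq = begin
    (m ℕ.+ t) ℕ.% n                   ≡⟨ ℕ.%-distribˡ-+ m t n ⟩
    (m ℕ.% n ℕ.+ t ℕ.% n) ℕ.% n       ≡⟨ cong (λ r → (r ℕ.+ t ℕ.% n) ℕ.% n) eq ⟩
    (o ℕ.% n ℕ.+ t ℕ.% n) ℕ.% n       ≡⟨ ℕ.%-distribˡ-+ o t n ⟨
    (o ℕ.+ t) ℕ.% n                   ∎
    where open ≡-Reasoning
  cancel : ∀ m → (m ℕ.+ d ℕ.+ (d ℕ.* n ℕ.∸ d)) ℕ.% n ≡ m ℕ.% n
  cancel m = begin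
    (m ℕ.+ d ℕ.+ (d ℕ.* n ℕ.∸ d)) ℕ.% n  ≡⟨ cong (ℕ._% n) (ℕ.+-assoc m d _) ⟩
    (m ℕ.+ (d ℕ.+ (d ℕ.* n ℕ.∸ d))) ℕ.% n ≡⟨ cong (λ t → (m ℕ.+ t) ℕ.% n) (ℕ.m+[n∸m]≡n (ℕ.m≤m*n d n)) ⟩
    (m ℕ.+ d ℕ.* n) ℕ.% n                ≡⟨ ℕ.[m+kn]%n≡m%n m d n ⟩
    m ℕ.% n                              ∎
    where open ≡-Reasoning

-- The order ≺_s as a lexicographic order

≤ᵇ∧≤ᵇ≡does-≟ : ∀ i j → ((i ℤ.≤ᵇ j) ∧ (j ℤ.≤ᵇ i)) ≡ does (i ℤ.≟ j)
≤ᵇ∧≤ᵇ≡does-≟ i j = does-⇔ (mk⇔ (λ (i≤j , j≤i) → ℤ.≤-antisym (ℤ.≤ᵇ⇒≤ i≤j) (ℤ.≤ᵇ⇒≤ j≤i))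
                                 (λ { refl → ℤ.≤⇒≤ᵇ (ℤ.≤-refl {i}) , ℤ.≤⇒≤ᵇ (ℤ.≤-refl {i}) }))
                           (T? (i ℤ.≤ᵇ j) ×-dec T? (j ℤ.≤ᵇ i)) (i ℤ.≟ j)

≤ᵇ∧≰ᵇ≡does-<? : ∀ i j → ((i ℤ.≤ᵇ j) ∧ not (j ℤ.≤ᵇ i)) ≡ does (i ℤ.<? j)
≤ᵇ∧≰ᵇ≡does-<? i j = does-⇔ (mk⇔ (λ (_ , j≰i) → ℤ.≰⇒> (λ j≤i → j≰i (ℤ.≤⇒≤ᵇ j≤i)))
                                 (λ i<j → ℤ.≤⇒≤ᵇ (ℤ.<⇒≤ i<j) , λ j≤i → ℤ.<⇒≱ i<j (ℤ.≤ᵇ⇒≤ j≤i)))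
                           (T? (i ℤ.≤ᵇ j) ×-dec ¬? (T? (j ℤ.≤ᵇ i))) (i ℤ.<? j)

<ᵇ≡does-<? : ∀ m n → (m ℕ.<ᵇ n) ≡ does (m ℕ.<? n)
<ᵇ≡does-<? m n = does-⇔ (mk⇔ (ℕ.<ᵇ⇒< m n) ℕ.<⇒<ᵇ) (T? (m ℕ.<ᵇ n)) (m ℕ.<? n)

does≡true⇒ : ∀ {A : Set} (a? : Dec A) → does a? ≡ true → A
does≡true⇒ (yes a) _ = a

does-exclusive : ∀ {A B : Set} (a? : Dec A) (b? : Dec B) → ¬ (A × B) → A ⊎ B → does a? ≡ not (does b?)
does-exclusive (yes a) (yes b) ¬a×b _ = ⊥-elim (¬a×b (a , b))
does-exclusive (yes _) (no _)  _    _ = refl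
does-exclusive (no _)  (yes _) _    _ = refl
does-exclusive (no ¬a) (no ¬b) _  a⊎b = ⊥-elim ([ ¬a , ¬b ] a⊎b)

module ContentOrder {l : ℕ} (s : Vec ℤ l) where

  key : Node l → ℤ × ℕ
  key x = content s x , toℕ (comp x)

  _≺_ : Node l → Node l → Set
  x ≺ y = ×-Lex _≡_ ℤ._<_ ℕ._>_ (key x) (key y)

  _≺?_ : Decidable _≺_
  x ≺? y = ×-decidable ℤ._≟_ ℤ._<?_ ℕ._>?_ (key x) (key y)

  precᵇ≡does-≺? : ∀ x y → precᵇ s x y ≡ does (x ≺? y)
  precᵇ≡does-≺? x y = cong₂ _∨_ (≤ᵇ∧≰ᵇ≡does-<? cx cy)
    (trans (sym (∧-assoc (cx ℤ.≤ᵇ cy) (cy ℤ.≤ᵇ cx) _))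
           (cong₂ _∧_ (≤ᵇ∧≤ᵇ≡does-≟ cx cy) (<ᵇ≡does-<? (toℕ (comp y)) (toℕ (comp x)))))
    where cx = content s x
          cy = content s y

  ≺-trans : Transitive _≺_
  ≺-trans {x} {y} {z} =
    ×-transitive isEquivalence (resp₂ ℤ._<_) ℤ.<-trans
                 (λ {m n o} (m>n : m ℕ.> n) (n>o : n ℕ.> o) → ℕ.<-trans n>o m>n) {key x} {key y} {key z}

  ≺-asym : Asymmetric _≺_
  ≺-asym {x} {y} =
    ×-asymmetric sym (resp₂ ℤ._<_) ℤ.<-asym (λ {m n} (m>n : m ℕ.> n) → ℕ.<-asym m>n) {key x} {key y}

  ≺-total-on-distinct-comps : ∀ x y → comp x ≢ comp y → x ≺ y ⊎ y ≺ x
  ≺-total-on-distinct-comps x y comps≢ with ℤ.<-cmp (content s x) (content s y)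
  ... | tri< cx<cy _ _ = inj₁ (inj₁ cx<cy)
  ... | tri> _ _ cy<cx = inj₂ (inj₁ cy<cx)
  ... | tri≈ _ cx≡cy _ with ℕ.<-cmp (toℕ (comp x)) (toℕ (comp y))
  ...   | tri< kx<ky _ _ = inj₂ (inj₂ (sym cx≡cy , kx<ky))
  ...   | tri≈ _ kx≡ky _ = ⊥-elim (comps≢ (toℕ-injective kx≡ky))
  ...   | tri> _ _ ky<kx = inj₁ (inj₂ (cx≡cy , ky<kx))

  precᵇ-flip : ∀ x y → comp x ≢ comp y → precᵇ s x y ≡ not (precᵇ s y x)
  precᵇ-flip x y comps≢ = begin
    precᵇ s x y          ≡⟨ precᵇ≡does-≺? x y ⟩
    does (x ≺? y)        ≡⟨ does-exclusive (x ≺? y) (y ≺? x) (λ (x≺y , y≺x) → ≺-asym {x} {y} x≺y y≺x)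
                                           (≺-total-on-distinct-comps x y comps≢) ⟩
    not (does (y ≺? x))  ≡⟨ cong not (precᵇ≡does-≺? y x) ⟨
    not (precᵇ s y x)    ∎
    where open ≡-Reasoning

  precᵇ≡true⇒≺ : ∀ x y → precᵇ s x y ≡ true → x ≺ y
  precᵇ≡true⇒≺ x y eq = does≡true⇒ (x ≺? y) (trans (sym (precᵇ≡does-≺? x y)) eq)

  precᵇ-trans : ∀ {x y z} → precᵇ s x y ≡ true → precᵇ s y z ≡ true → precᵇ s x z ≡ true
  precᵇ-trans {x} {y} {z} x≺y y≺z =
    trans (precᵇ≡does-≺? x z)
          (dec-true (x ≺? z) (≺-trans {x} {y} {z} (precᵇ≡true⇒≺ x y x≺y) (precᵇ≡true⇒≺ y z y≺z)))

  ≺⇔≤-content : ∀ x y → toℕ (comp y) ℕ.< toℕ (comp x) → x ≺ y ⇔ content s x ℤ.≤ content s y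
  ≺⇔≤-content x y ky<kx = mk⇔ [ ℤ.<⇒≤ , (λ (cx≡cy , _) → ℤ.≤-reflexive cx≡cy) ]
    (λ cx≤cy → case content s x ℤ.≟ content s y of λ where
       (yes cx≡cy) → inj₂ (cx≡cy , ky<kx)
       (no cx≢cy)  → inj₁ (ℤ.≤∧≢⇒< cx≤cy cx≢cy))

  ≺⇔<-content : ∀ x y → toℕ (comp x) ℕ.≤ toℕ (comp y) → x ≺ y ⇔ content s x ℤ.< content s y
  ≺⇔<-content x y kx≤ky = mk⇔ [ id , (λ (_ , ky<kx) → ⊥-elim (ℕ.≤⇒≯ kx≤ky ky<kx)) ] inj₁

-- Insertion sort and the reduction of signatures

module _ {X : Set} {lt : X → X → Bool} {Q : X → Set} where

  All-insertBy : ∀ {x ys} → Q x → All Q ys → All Q (insertBy lt x ys)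
  All-insertBy {x} {[]}     qx []         = qx ∷ []
  All-insertBy {x} {y ∷ ys} qx (qy ∷ qys) with lt x y
  ... | true  = qx ∷ qy ∷ qys
  ... | false = qy ∷ All-insertBy qx qys

  All-sortBy : ∀ {xs} → All Q xs → All Q (sortBy lt xs)
  All-sortBy []         = []
  All-sortBy (qx ∷ qxs) = All-insertBy qx (All-sortBy qxs)

module _ {X Y : Set} {ltX : X → X → Bool} {ltY : Y → Y → Bool} (f : X → Y) {Q : X → Set}
         (f-monotone : ∀ {x y} → Q x → Q y → ltY (f x) (f y) ≡ ltX x y) where

  insertBy-map : ∀ {x ys} → Q x → All Q ys → insertBy ltY (f x) (map f ys) ≡ map f (insertBy ltX x ys)
  insertBy-map {x} {[]}     qx []         = refl
  insertBy-map {x} {y ∷ ys} qx (qy ∷ qys) rewrite f-monotone qx qy with ltX x y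
  ... | true  = refl
  ... | false = cong (f y ∷_) (insertBy-map qx qys)

  sortBy-map : ∀ {xs} → All Q xs → sortBy ltY (map f xs) ≡ map f (sortBy ltX xs)
  sortBy-map {[]}     []         = refl
  sortBy-map {x ∷ xs} (qx ∷ qxs) =
    trans (cong (insertBy ltY (f x)) (sortBy-map qxs)) (insertBy-map qx (All-sortBy qxs))

module _ {X Y : Set} (f : X → Y) where

  private
    mapNodes : List (Sign × X) → List (Sign × Y)
    mapNodes = map (map₂ f)

  reduceRA-map : ∀ acc w → reduceRA (mapNodes acc) (mapNodes w) ≡ mapNodes (reduceRA acc w)
  reduceRA-map acc              []            = refl
  reduceRA-map []               (x ∷ w)       = reduceRA-map (x ∷ []) w
  reduceRA-map ((A , y) ∷ acc)  (x ∷ w)       = reduceRA-map (x ∷ (A , y) ∷ acc) w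
  reduceRA-map ((R , y) ∷ acc)  ((A , x) ∷ w) = reduceRA-map acc w
  reduceRA-map ((R , y) ∷ acc)  ((R , x) ∷ w) = reduceRA-map ((R , x) ∷ (R , y) ∷ acc) w

  firstA-map : ∀ w → firstA (mapNodes w) ≡ Maybe.map f (firstA w)
  firstA-map []            = refl
  firstA-map ((A , x) ∷ w) = refl
  firstA-map ((R , x) ∷ w) = firstA-map w

Comparable : {X : Set} → (X → X → Bool) → X → X → Set
Comparable lt a b = lt a b ≡ not (lt b a)

module _ {X : Set} (lt : X → X → Bool)
         (lt-trans : ∀ {x y z} → lt x y ≡ true → lt y z ≡ true → lt x z ≡ true) where

  private
    insert = insertBy lt

  insertBy-comm-< : ∀ {a b} → lt a b ≡ true → lt b a ≡ false →
                    ∀ L → insert a (insert b L) ≡ insert b (insert a L)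
  insertBy-comm-< a<b b≮a [] rewrite a<b | b≮a = refl
  insertBy-comm-< {a} {b} a<b b≮a (y ∷ ys) with lt b y in b<y | lt a y in a<y
  ... | true  | true  rewrite a<b | b≮a | b<y = refl
  ... | true  | false with () ← trans (sym (lt-trans a<b b<y)) a<y
  ... | false | true  rewrite b≮a | b<y | a<y = refl
  ... | false | false rewrite b<y | a<y = cong (y ∷_) (insertBy-comm-< a<b b≮a ys)

  insertBy-comm : ∀ {a b} → Comparable lt a b →
                  ∀ L → insert a (insert b L) ≡ insert b (insert a L)
  insertBy-comm {a} {b} a<b≡b≮a L with lt a b in a<b | lt b a in b<a
  ... | true  | false = insertBy-comm-< a<b b<a L
  ... | false | true  = sym (insertBy-comm-< b<a a<b L)
  ... | true  | true  with () ← a<b≡b≮a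
  ... | false | false with () ← a<b≡b≮a

  foldr-insertBy-comm : ∀ a Bs L → All (Comparable lt a) Bs →
                        insert a (foldr insert L Bs) ≡ foldr insert (insert a L) Bs
  foldr-insertBy-comm a []       L []         = refl
  foldr-insertBy-comm a (b ∷ Bs) L (a~b ∷ a~Bs) =
    trans (insertBy-comm a~b (foldr insert L Bs)) (cong (insert b) (foldr-insertBy-comm a Bs L a~Bs))

  foldr-insertBy-swap : ∀ As Bs L → All (λ a → All (Comparable lt a) Bs) As →
                        foldr insert (foldr insert L Bs) As ≡ foldr insert (foldr insert L As) Bs
  foldr-insertBy-swap []       Bs L []           = refl
  foldr-insertBy-swap (a ∷ As) Bs L (a~Bs ∷ As~Bs) =
    trans (cong (insert a) (foldr-insertBy-swap As Bs L As~Bs)) (foldr-insertBy-comm a Bs (foldr insert L As) a~Bs)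

  sortBy-++-comm : ∀ As Bs → All (λ a → All (Comparable lt a) Bs) As → sortBy lt (As ++ Bs) ≡ sortBy lt (Bs ++ As)
  sortBy-++-comm As Bs As~Bs = begin
    foldr insert [] (As ++ Bs)              ≡⟨ List.foldr-++ insert [] As Bs ⟩
    foldr insert (foldr insert [] Bs) As    ≡⟨ foldr-insertBy-swap As Bs [] As~Bs ⟩
    foldr insert (foldr insert [] As) Bs    ≡⟨ List.foldr-++ insert [] Bs As ⟨
    foldr insert [] (Bs ++ As)              ∎
    where open ≡-Reasoning

-- Cyclic rotation of components

data LastOrInject : ∀ {k} → Fin (suc k) → Set where
  isLast     : ∀ {k} → LastOrInject (fromℕ k)
  isInject₁ : ∀ {k} (c : Fin k) → LastOrInject (inject₁ c)

lastOrInject : ∀ {k} (c : Fin (suc k)) → LastOrInject c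
lastOrInject {zero}  zero    = isLast
lastOrInject {suc k} zero    = isInject₁ zero
lastOrInject {suc k} (suc c) with lastOrInject c
... | isLast      = isLast
... | isInject₁ c = isInject₁ (suc c)

rotateFin : ∀ {k} → Fin (suc k) → Fin (suc k)
rotateFin {zero}  zero    = zero
rotateFin {suc k} zero    = suc zero
rotateFin {suc k} (suc c) with rotateFin c
... | zero   = zero
... | suc c′ = suc (suc c′)

rotateFin-fromℕ : ∀ k → rotateFin (fromℕ k) ≡ zero
rotateFin-fromℕ zero    = refl
rotateFin-fromℕ (suc k) rewrite rotateFin-fromℕ k = refl

rotateFin-inject₁ : ∀ {k} (c : Fin k) → rotateFin (inject₁ c) ≡ suc c
rotateFin-inject₁ {suc k} zero    = refl
rotateFin-inject₁ {suc k} (suc c) rewrite rotateFin-inject₁ c = refl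

toList-allFin-suc : ∀ k → toList (allFin (suc k)) ≡ zero ∷ map suc (toList (allFin k))
toList-allFin-suc k = trans (cong toList (Vec.allFin-map k)) (cong (zero ∷_) (Vec.toList-map suc (allFin k)))

toList-allFin-∷ʳ : ∀ k → toList (allFin (suc k)) ≡ map inject₁ (toList (allFin k)) ++ fromℕ k ∷ []
toList-allFin-∷ʳ zero    = refl
toList-allFin-∷ʳ (suc k) = begin
  toList (allFin (suc (suc k)))                                 ≡⟨ toList-allFin-suc (suc k) ⟩
  zero ∷ map suc (toList (allFin (suc k)))                      ≡⟨ cong (λ cs → zero ∷ map suc cs) (toList-allFin-∷ʳ k) ⟩
  zero ∷ map suc (map inject₁ cs ++ fromℕ k ∷ [])               ≡⟨ cong (zero ∷_) (List.map-++ suc (map inject₁ cs) _) ⟩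
  zero ∷ (map suc (map inject₁ cs) ++ fromℕ (suc k) ∷ [])
    ≡⟨ cong (λ cs′ → zero ∷ (cs′ ++ fromℕ (suc k) ∷ [])) suc∘inject₁ ⟩
  zero ∷ (map inject₁ (map suc cs) ++ fromℕ (suc k) ∷ [])
    ≡⟨ cong (λ cs′ → map inject₁ cs′ ++ fromℕ (suc k) ∷ []) (toList-allFin-suc k) ⟨
  map inject₁ (toList (allFin (suc k))) ++ fromℕ (suc k) ∷ []   ∎
  where
  open ≡-Reasoning
  cs = toList (allFin k)
  suc∘inject₁ : map suc (map inject₁ cs) ≡ map inject₁ (map suc cs)
  suc∘inject₁ = trans (sym (List.map-∘ cs)) (List.map-∘ cs)

toList-allFin-rotateFin : ∀ k → toList (allFin (suc k)) ≡ map rotateFin (fromℕ k ∷ map inject₁ (toList (allFin k)))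
toList-allFin-rotateFin k = begin
  toList (allFin (suc k))                                ≡⟨ toList-allFin-suc k ⟩
  zero ∷ map suc cs                                      ≡⟨ cong₂ _∷_ (rotateFin-fromℕ k) (List.map-cong rotateFin-inject₁ cs) ⟨
  rotateFin (fromℕ k) ∷ map (rotateFin ∘ inject₁) cs     ≡⟨ cong (rotateFin (fromℕ k) ∷_) (List.map-∘ cs) ⟩
  map rotateFin (fromℕ k ∷ map inject₁ cs)               ∎
  where
  open ≡-Reasoning
  cs = toList (allFin k)

module _ {A : Set} where

  lookup-fromℕ : ∀ {k} (v : Vec A (suc k)) → lookup v (fromℕ k) ≡ Vec.last v
  lookup-fromℕ {zero}  (x ∷ Vec.[]) = refl
  lookup-fromℕ {suc k} (x ∷ v) = lookup-fromℕ v

  lookup-inject₁ : ∀ {k} (v : Vec A (suc k)) (c : Fin k) → lookup v (inject₁ c) ≡ lookup (Vec.init v) c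
  lookup-inject₁ (x ∷ v) zero    = refl
  lookup-inject₁ (x ∷ v) (suc c) = lookup-inject₁ v c

  lookup-rotate : ∀ {k} (v : Vec A (suc k)) c → lookup (rotate v) (rotateFin c) ≡ lookup v c
  lookup-rotate {k} v c with lastOrInject c
  ... | isLast      rewrite rotateFin-fromℕ k = sym (lookup-fromℕ v)
  ... | isInject₁ c rewrite rotateFin-inject₁ c = sym (lookup-inject₁ v c)

  last-updateAt-fromℕ : ∀ {k} (v : Vec A (suc k)) f → Vec.last (updateAt v (fromℕ k) f) ≡ f (Vec.last v)
  last-updateAt-fromℕ {zero}  (x ∷ Vec.[]) f = refl
  last-updateAt-fromℕ {suc k} (x ∷ v) f = last-updateAt-fromℕ v f

  init-updateAt-fromℕ : ∀ {k} (v : Vec A (suc k)) f → Vec.init (updateAt v (fromℕ k) f) ≡ Vec.init v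
  init-updateAt-fromℕ {zero}  (x ∷ Vec.[]) f = refl
  init-updateAt-fromℕ {suc k} (x ∷ v) f = cong (x ∷_) (init-updateAt-fromℕ v f)

  last-updateAt-inject₁ : ∀ {k} (v : Vec A (suc k)) (c : Fin k) f → Vec.last (updateAt v (inject₁ c) f) ≡ Vec.last v
  last-updateAt-inject₁ (x ∷ y ∷ v) zero    f = refl
  last-updateAt-inject₁ (x ∷ v)     (suc c) f = last-updateAt-inject₁ v c f

  init-updateAt-inject₁ : ∀ {k} (v : Vec A (suc k)) (c : Fin k) f →
                          Vec.init (updateAt v (inject₁ c) f) ≡ updateAt (Vec.init v) c f
  init-updateAt-inject₁ (x ∷ v) zero    f = refl
  init-updateAt-inject₁ (x ∷ v) (suc c) f = cong (x ∷_) (init-updateAt-inject₁ v c f)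

  updateAt-rotate : ∀ {k} (v : Vec A (suc k)) c f → updateAt (rotate v) (rotateFin c) f ≡ rotate (updateAt v c f)
  updateAt-rotate {k} v c f with lastOrInject c
  ... | isLast      rewrite rotateFin-fromℕ k   | last-updateAt-fromℕ v f   | init-updateAt-fromℕ v f   = refl
  ... | isInject₁ c rewrite rotateFin-inject₁ c | last-updateAt-inject₁ v c f | init-updateAt-inject₁ v c f = refl

  rotate-replicate : ∀ k (x : A) → rotate (replicate (suc k) x) ≡ replicate (suc k) x
  rotate-replicate k x = cong₂ _∷_ (last-replicate k) (init-replicate k)
    where
    last-replicate : ∀ k → Vec.last (replicate (suc k) x) ≡ x
    last-replicate zero    = refl
    last-replicate (suc k) = last-replicate k
    init-replicate : ∀ k → Vec.init (replicate (suc k) x) ≡ replicate k x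
    init-replicate zero    = refl
    init-replicate (suc k) = cong (x ∷_) (init-replicate k)

-- Rotation for the charge (0, e/l, …, (l − 1)e/l)

module ⇔-Reasoning = EquationalReasoning {k = equivalence}

filterᵇ-map : ∀ {X Y : Set} (p : X → Bool) (q : Y → Bool) (f : X → Y) → (∀ x → q (f x) ≡ p x) →
              ∀ xs → filterᵇ q (map f xs) ≡ map f (filterᵇ p xs)
filterᵇ-map p q f q∘f≗p []       = refl
filterᵇ-map p q f q∘f≗p (x ∷ xs) rewrite q∘f≗p x with p x
... | true  = cong (f x ∷_) (filterᵇ-map p q f q∘f≗p xs)
... | false = filterᵇ-map p q f q∘f≗p xs

module UglovCharge (k e₀ : ℕ) (d*l≡e : divℕ (suc e₀) (suc k) ℕ.* suc k ≡ suc e₀) where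

  private
    l = suc k
    e = suc e₀
    d = divℕ e l
    s = uglovCharge e l

  open ContentOrder s

  lookup-uglovCharge : ∀ c → lookup s c ≡ + (toℕ c ℕ.* d)
  lookup-uglovCharge c =
    trans (Vec.lookup-map c _ (allFin l)) (cong (λ c → + (toℕ c ℕ.* d)) (Vec.lookup-allFin c))

  charge-suc : ∀ (c : Fin k) → lookup s (suc c) ≡ lookup s (inject₁ c) + + d
  charge-suc c rewrite lookup-uglovCharge (suc c) | lookup-uglovCharge (inject₁ c) | toℕ-inject₁ c =
    cong +_ (ℕ.+-comm d (toℕ c ℕ.* d))

  charge-wrap : lookup s zero + + e ≡ lookup s (fromℕ k) + + d
  charge-wrap rewrite lookup-uglovCharge (fromℕ k) | toℕ-fromℕ k =
    cong +_ (trans (sym d*l≡e) (trans (ℕ.*-comm d l) (ℕ.+-comm d (k ℕ.* d))))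

  content-suc : ∀ a b (c : Fin k) → content s (node a b (suc c)) ≡ content s (node a b (inject₁ c)) + + d
  content-suc a b c = trans (cong (λ t → + b ℤ.- + a + t) (charge-suc c)) (sym (ℤ.+-assoc (+ b ℤ.- + a) _ (+ d)))

  content-wrap : ∀ a b → content s (node a b zero) + + e ≡ content s (node a b (fromℕ k)) + + d
  content-wrap a b = begin
    + b ℤ.- + a + lookup s zero + + e         ≡⟨ ℤ.+-assoc (+ b ℤ.- + a) _ (+ e) ⟩
    + b ℤ.- + a + (lookup s zero + + e)       ≡⟨ cong (λ t → + b ℤ.- + a + t) charge-wrap ⟩
    + b ℤ.- + a + (lookup s (fromℕ k) + + d)  ≡⟨ ℤ.+-assoc (+ b ℤ.- + a) _ (+ d) ⟨
    + b ℤ.- + a + lookup s (fromℕ k) + + d    ∎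
    where open ≡-Reasoning

  inject₁<fromℕ : ∀ (c : Fin k) → toℕ (inject₁ c) ℕ.< toℕ (fromℕ k)
  inject₁<fromℕ c = subst₂ ℕ._<_ (sym (toℕ-inject₁ c)) (sym (toℕ-fromℕ k)) (toℕ<n c)

  rotateNode : Node l → Node l
  rotateNode (node a b c) = node a b (rotateFin c)

  residue-rotateNode : ∀ x → resℤ e (content s (rotateNode x)) ≡ (resℤ e (content s x) ℕ.+ d) ℕ.% e
  residue-rotateNode (node a b c) with lastOrInject c
  ... | isLast rewrite rotateFin-fromℕ k = begin
    content s (node a b zero) %ℕ e                     ≡⟨ [i+e]%ℕe≡i%ℕe e (content s (node a b zero)) ⟨
    (content s (node a b zero) + + e) %ℕ e             ≡⟨ cong (_%ℕ e) (content-wrap a b) ⟩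
    (content s (node a b (fromℕ k)) + + d) %ℕ e        ≡⟨ [i+n]%ℕe≡[i%ℕe+n]%e e (content s (node a b (fromℕ k))) d ⟩
    (content s (node a b (fromℕ k)) %ℕ e ℕ.+ d) ℕ.% e  ∎
    where open ≡-Reasoning
  ... | isInject₁ c rewrite rotateFin-inject₁ c =
    trans (cong (_%ℕ e) (content-suc a b c)) ([i+n]%ℕe≡[i%ℕe+n]%e e (content s (node a b (inject₁ c))) d)

  -- The shape of content-suc that ≤-shift-⇔ and <-shift-⇔ expect.
  content-suc+0 : ∀ a b (c : Fin k) → content s (node a b (suc c)) + 0ℤ ≡ content s (node a b (inject₁ c)) + + d
  content-suc+0 a b c = trans (ℤ.+-identityʳ _) (content-suc a b c)

  content-suc+e : ∀ a b (c : Fin k) →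
                  content s (node a b (suc c)) + + e ≡ content s (node a b (inject₁ c)) + + e + + d
  content-suc+e a b c =
    trans (cong (_+ + e) (content-suc a b c)) (xy∙z≈xz∙y (content s (node a b (inject₁ c))) (+ d) (+ e))

  module _ (a b a′ b′ : ℕ) where

    ≺-rotate-last-last : node a b zero ≺ node a′ b′ zero ⇔ node a b (fromℕ k) ≺ node a′ b′ (fromℕ k)
    ≺-rotate-last-last = begin
      ρx ≺ ρy                          ∼⟨ ≺⇔<-content ρx ρy ℕ.z≤n ⟩
      content s ρx ℤ.< content s ρy    ∼⟨ <-shift-⇔ (+ e) (+ d) (content-wrap a b) (content-wrap a′ b′) ⟩
      content s x ℤ.< content s y      ∼⟨ ⇔.sym (≺⇔<-content x y ℕ.≤-refl) ⟩
      x ≺ y                            ∎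
      where
      open ⇔-Reasoning
      x  = node a b (fromℕ k)
      y  = node a′ b′ (fromℕ k)
      ρx = node a b zero
      ρy = node a′ b′ zero

    ≺-rotate-last-inject₁ : ∀ c′ → let x = node a b (fromℕ k); y = node a′ b′ (inject₁ c′) in
      resℤ e (content s x) ≡ resℤ e (content s y) → node a b zero ≺ node a′ b′ (suc c′) ⇔ x ≺ y
    ≺-rotate-last-inject₁ c′ x≡y = begin
      ρx ≺ ρy                              ∼⟨ ≺⇔<-content ρx ρy ℕ.z≤n ⟩
      content s ρx ℤ.< content s ρy        ∼⟨ <-shift-⇔ (+ e) (+ d) (content-wrap a b) (content-suc+e a′ b′ c′) ⟩
      content s x ℤ.< content s y + + e    ∼⟨ ⇔.sym (≤⇔<+e e x≡y) ⟩
      content s x ℤ.≤ content s y          ∼⟨ ⇔.sym (≺⇔≤-content x y (inject₁<fromℕ c′)) ⟩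
      x ≺ y                                ∎
      where
      open ⇔-Reasoning
      x  = node a b (fromℕ k)
      y  = node a′ b′ (inject₁ c′)
      ρx = node a b zero
      ρy = node a′ b′ (suc c′)

    ≺-rotate-inject₁-last : ∀ c → let x = node a b (inject₁ c); y = node a′ b′ (fromℕ k) in
      resℤ e (content s x) ≡ resℤ e (content s y) → node a b (suc c) ≺ node a′ b′ zero ⇔ x ≺ y
    ≺-rotate-inject₁-last c x≡y = begin
      ρx ≺ ρy                              ∼⟨ ≺⇔≤-content ρx ρy ℕ.z<s ⟩
      content s ρx ℤ.≤ content s ρy        ∼⟨ ≤-shift-⇔ (+ e) (+ d) (content-suc+e a b c) (content-wrap a′ b′) ⟩
      content s x + + e ℤ.≤ content s y    ∼⟨ ⇔.sym (<⇔+e≤ e x≡y) ⟩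
      content s x ℤ.< content s y          ∼⟨ ⇔.sym (≺⇔<-content x y (ℕ.<⇒≤ (inject₁<fromℕ c))) ⟩
      x ≺ y                                ∎
      where
      open ⇔-Reasoning
      x  = node a b (inject₁ c)
      y  = node a′ b′ (fromℕ k)
      ρx = node a b (suc c)
      ρy = node a′ b′ zero

    ≺-rotate-inject₁-inject₁ : ∀ c c′ →
      node a b (suc c) ≺ node a′ b′ (suc c′) ⇔ node a b (inject₁ c) ≺ node a′ b′ (inject₁ c′)
    ≺-rotate-inject₁-inject₁ c c′ with toℕ c′ ℕ.<? toℕ c
    ... | yes c′<c = begin
      ρx ≺ ρy                          ∼⟨ ≺⇔≤-content ρx ρy (ℕ.s<s c′<c) ⟩
      content s ρx ℤ.≤ content s ρy    ∼⟨ ≤-shift-⇔ 0ℤ (+ d) (content-suc+0 a b c) (content-suc+0 a′ b′ c′) ⟩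
      content s x ℤ.≤ content s y      ∼⟨ ⇔.sym (≺⇔≤-content x y ky<kx) ⟩
      x ≺ y                            ∎
      where
      open ⇔-Reasoning
      x  = node a b (inject₁ c)
      y  = node a′ b′ (inject₁ c′)
      ρx = node a b (suc c)
      ρy = node a′ b′ (suc c′)
      ky<kx = subst₂ ℕ._<_ (sym (toℕ-inject₁ c′)) (sym (toℕ-inject₁ c)) c′<c
    ... | no c′≮c = begin
      ρx ≺ ρy                          ∼⟨ ≺⇔<-content ρx ρy (ℕ.s≤s c≤c′) ⟩
      content s ρx ℤ.< content s ρy    ∼⟨ <-shift-⇔ 0ℤ (+ d) (content-suc+0 a b c) (content-suc+0 a′ b′ c′) ⟩
      content s x ℤ.< content s y      ∼⟨ ⇔.sym (≺⇔<-content x y kx≤ky) ⟩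
      x ≺ y                            ∎
      where
      open ⇔-Reasoning
      x  = node a b (inject₁ c)
      y  = node a′ b′ (inject₁ c′)
      ρx = node a b (suc c)
      ρy = node a′ b′ (suc c′)
      c≤c′ = ℕ.≮⇒≥ c′≮c
      kx≤ky = subst₂ ℕ._≤_ (sym (toℕ-inject₁ c)) (sym (toℕ-inject₁ c′)) c≤c′

  ≺-rotateNode : ∀ x y → resℤ e (content s x) ≡ resℤ e (content s y) → rotateNode x ≺ rotateNode y ⇔ x ≺ y
  ≺-rotateNode (node a b c) (node a′ b′ c′) x≡y with lastOrInject c | lastOrInject c′
  ... | isLast      | isLast       rewrite rotateFin-fromℕ k = ≺-rotate-last-last a b a′ b′
  ... | isLast      | isInject₁ c′ rewrite rotateFin-fromℕ k | rotateFin-inject₁ c′ =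
    ≺-rotate-last-inject₁ a b a′ b′ c′ x≡y
  ... | isInject₁ c | isLast       rewrite rotateFin-fromℕ k | rotateFin-inject₁ c =
    ≺-rotate-inject₁-last a b a′ b′ c x≡y
  ... | isInject₁ c | isInject₁ c′ rewrite rotateFin-inject₁ c | rotateFin-inject₁ c′ =
    ≺-rotate-inject₁-inject₁ a b a′ b′ c c′

  precᵇ-rotateNode : ∀ x y → resℤ e (content s x) ≡ resℤ e (content s y) →
                     precᵇ s (rotateNode x) (rotateNode y) ≡ precᵇ s x y
  precᵇ-rotateNode x y x≡y = begin
    precᵇ s (rotateNode x) (rotateNode y)  ≡⟨ precᵇ≡does-≺? (rotateNode x) (rotateNode y) ⟩
    does (rotateNode x ≺? rotateNode y)    ≡⟨ does-⇔ (≺-rotateNode x y x≡y) (rotateNode x ≺? rotateNode y) (x ≺? y) ⟩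
    does (x ≺? y)                          ≡⟨ precᵇ≡does-≺? x y ⟨
    precᵇ s x y                            ∎
    where open ≡-Reasoning

  -- hasResidue and markedNodes are the functions inside the definition of iNodes, which
  -- therefore unfolds to  filterᵇ (hasResidue i) (concatMap (markedNodes λ′) components).
  hasResidue : ℕ → Sign × Node l → Bool
  hasResidue i (_ , x) = resℤ e (content s x) ℕ.≡ᵇ resℕ e i

  markedNodes : LPartition l → Fin l → List (Sign × Node l)
  markedNodes λ′ c = map (λ (a , b) → A , node a b c) (addablesP (lookup λ′ c))
                  ++ map (λ (a , b) → R , node a b c) (removablesP (lookup λ′ c))

  rotateSigned : Sign × Node l → Sign × Node l
  rotateSigned = map₂ rotateNode

  hasResidue-rotate : ∀ i j → resℕ e j ≡ (i ℕ.+ d) ℕ.% e →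
                      ∀ x → hasResidue j (rotateSigned x) ≡ hasResidue i x
  hasResidue-rotate i j j≡i+d (_ , x) = begin
    (resℤ e (content s (rotateNode x)) ℕ.≡ᵇ resℕ e j)      ≡⟨ cong₂ ℕ._≡ᵇ_ (residue-rotateNode x) j≡i+d ⟩
    ((r ℕ.+ d) ℕ.% e ℕ.≡ᵇ (i ℕ.+ d) ℕ.% e)
      ≡⟨ does-⇔ (⇔.trans r≡i⇔ (m%n≡o%n⇔[m+d]%n≡[o+d]%n r i d e)) (_ ℕ.≟ _) (_ ℕ.≟ _) ⟨
    (r ℕ.≡ᵇ i ℕ.% e)                                        ∎
    where
    open ≡-Reasoning
    r = resℤ e (content s x)
    r≡i⇔ : r ≡ i ℕ.% e ⇔ r ℕ.% e ≡ i ℕ.% e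
    r≡i⇔ rewrite ℕ.m<n⇒m%n≡m (n%ℕd<d (content s x) e) = ⇔.refl

  markedNodes-rotate : ∀ λ′ c → markedNodes (rotate λ′) (rotateFin c) ≡ map rotateSigned (markedNodes λ′ c)
  markedNodes-rotate λ′ c rewrite lookup-rotate λ′ c =
    sym (trans (List.map-++ rotateSigned (map _ (addablesP (lookup λ′ c))) _)
               (cong₂ _++_ (sym (List.map-∘ (addablesP (lookup λ′ c)))) (sym (List.map-∘ (removablesP (lookup λ′ c))))))

  All-comp-markedNodes : ∀ λ′ c → All (λ x → comp (proj₂ x) ≡ c) (markedNodes λ′ c)
  All-comp-markedNodes λ′ c =
    All.++⁺ (All.map⁺ (All.universal (λ _ → refl) (addablesP (lookup λ′ c))))
            (All.map⁺ (All.universal (λ _ → refl) (removablesP (lookup λ′ c))))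

  innerNodes lastNodes : ℕ → LPartition l → List (Sign × Node l)
  innerNodes i λ′ = filterᵇ (hasResidue i) (concatMap (markedNodes λ′) (map inject₁ (toList (allFin k))))
  lastNodes  i λ′ = filterᵇ (hasResidue i) (markedNodes λ′ (fromℕ k))

  iNodes-split : ∀ i λ′ → iNodes e s i λ′ ≡ innerNodes i λ′ ++ lastNodes i λ′
  iNodes-split i λ′ = begin
    filterᵇ (hasResidue i) (concatMap (markedNodes λ′) (toList (allFin l)))
      ≡⟨ cong (filterᵇ (hasResidue i) ∘ concatMap (markedNodes λ′)) (toList-allFin-∷ʳ k) ⟩
    filterᵇ (hasResidue i) (concatMap (markedNodes λ′) (inner ++ fromℕ k ∷ []))
      ≡⟨ cong (filterᵇ (hasResidue i)) (List.concatMap-++ (markedNodes λ′) inner (fromℕ k ∷ [])) ⟩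
    filterᵇ (hasResidue i) (concatMap (markedNodes λ′) inner ++ markedNodes λ′ (fromℕ k) ++ [])
      ≡⟨ cong (λ ns → filterᵇ (hasResidue i) (concatMap (markedNodes λ′) inner ++ ns)) (List.++-identityʳ _) ⟩
    filterᵇ (hasResidue i) (concatMap (markedNodes λ′) inner ++ markedNodes λ′ (fromℕ k))
      ≡⟨ List.filter-++ _ (concatMap (markedNodes λ′) inner) _ ⟩
    innerNodes i λ′ ++ lastNodes i λ′ ∎
    where
    open ≡-Reasoning
    inner = map inject₁ (toList (allFin k))

  iNodes-rotate : ∀ i j → resℕ e j ≡ (i ℕ.+ d) ℕ.% e →
                  ∀ λ′ → iNodes e s j (rotate λ′) ≡ map rotateSigned (lastNodes i λ′ ++ innerNodes i λ′)
  iNodes-rotate i j j≡i+d λ′ = begin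
    filterᵇ (hasResidue j) (concatMap (markedNodes (rotate λ′)) (toList (allFin l)))
      ≡⟨ cong (filterᵇ (hasResidue j) ∘ concatMap (markedNodes (rotate λ′))) (toList-allFin-rotateFin k) ⟩
    filterᵇ (hasResidue j) (concatMap (markedNodes (rotate λ′)) (map rotateFin cs))
      ≡⟨ cong (filterᵇ (hasResidue j)) (List.concatMap-map (markedNodes (rotate λ′)) rotateFin cs) ⟩
    filterᵇ (hasResidue j) (concatMap (markedNodes (rotate λ′) ∘ rotateFin) cs)
      ≡⟨ cong (filterᵇ (hasResidue j)) (List.concatMap-cong (markedNodes-rotate λ′) cs) ⟩
    filterᵇ (hasResidue j) (concatMap (map rotateSigned ∘ markedNodes λ′) cs)
      ≡⟨ cong (filterᵇ (hasResidue j)) (List.map-concatMap rotateSigned (markedNodes λ′) cs) ⟨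
    filterᵇ (hasResidue j) (map rotateSigned (concatMap (markedNodes λ′) cs))
      ≡⟨ filterᵇ-map (hasResidue i) (hasResidue j) rotateSigned (hasResidue-rotate i j j≡i+d) (concatMap (markedNodes λ′) cs) ⟩
    map rotateSigned (filterᵇ (hasResidue i) (concatMap (markedNodes λ′) cs))
      ≡⟨ cong (map rotateSigned) (List.filter-++ _ (markedNodes λ′ (fromℕ k)) _) ⟩
    map rotateSigned (lastNodes i λ′ ++ innerNodes i λ′) ∎
    where
    open ≡-Reasoning
    cs = fromℕ k ∷ map inject₁ (toList (allFin k))

  private
    LT : Sign × Node l → Sign × Node l → Bool
    LT x y = precᵇ s (proj₂ x) (proj₂ y)

    LT-trans : ∀ {x y z} → LT x y ≡ true → LT y z ≡ true → LT x z ≡ true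
    LT-trans {x} {y} {z} = precᵇ-trans {proj₂ x} {proj₂ y} {proj₂ z}

  innerNodes-comp : ∀ i λ′ → All (λ x → comp (proj₂ x) ≢ fromℕ k) (innerNodes i λ′)
  innerNodes-comp i λ′ = All.filter⁺ (T? ∘ hasResidue i) (All.concat⁺ (All.map⁺ (All.map⁺
    (All.universal (λ c → All.map (λ comp≡c comp≡k → fromℕ≢inject₁ (trans (sym comp≡k) comp≡c))
                                  (All-comp-markedNodes λ′ (inject₁ c)))
                   (toList (allFin k))))))

  lastNodes-comp : ∀ i λ′ → All (λ x → comp (proj₂ x) ≡ fromℕ k) (lastNodes i λ′)
  lastNodes-comp i λ′ = All.filter⁺ (T? ∘ hasResidue i) (All-comp-markedNodes λ′ (fromℕ k))

  signature-rotate : ∀ i j → resℕ e j ≡ (i ℕ.+ d) ℕ.% e →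
                     ∀ λ′ → signature e s j (rotate λ′) ≡ map rotateSigned (signature e s i λ′)
  signature-rotate i j j≡i+d λ′ = begin
    sortBy LT (iNodes e s j (rotate λ′))
      ≡⟨ cong (sortBy LT) (iNodes-rotate i j j≡i+d λ′) ⟩
    sortBy LT (map rotateSigned (lastNodes i λ′ ++ innerNodes i λ′))
      ≡⟨ sortBy-map {ltX = LT} {ltY = LT} rotateSigned (λ {x} {y} → LT-rotate {x} {y}) all∼i ⟩
    map rotateSigned (sortBy LT (lastNodes i λ′ ++ innerNodes i λ′))
      ≡⟨ cong (map rotateSigned) (sortBy-++-comm LT (λ {x} {y} {z} → LT-trans {x} {y} {z}) _ _ last~inner) ⟩
    map rotateSigned (sortBy LT (innerNodes i λ′ ++ lastNodes i λ′))
      ≡⟨ cong (map rotateSigned ∘ sortBy LT) (iNodes-split i λ′) ⟨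
    map rotateSigned (sortBy LT (iNodes e s i λ′))
      ∎
    where
    open ≡-Reasoning
    all∼i : All (T ∘ hasResidue i) (lastNodes i λ′ ++ innerNodes i λ′)
    all∼i = All.++⁺ (All.all-filter (T? ∘ hasResidue i) (markedNodes λ′ (fromℕ k)))
                    (All.all-filter (T? ∘ hasResidue i) (concatMap (markedNodes λ′) (map inject₁ (toList (allFin k)))))
    LT-rotate : ∀ {x y} → T (hasResidue i x) → T (hasResidue i y) → LT (rotateSigned x) (rotateSigned y) ≡ LT x y
    LT-rotate {_ , x} {_ , y} x∼i y∼i =
      precᵇ-rotateNode x y (trans (ℕ.≡ᵇ⇒≡ _ _ x∼i) (sym (ℕ.≡ᵇ⇒≡ _ _ y∼i)))
    last~inner : All (λ a → All (Comparable LT a) (innerNodes i λ′)) (lastNodes i λ′)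
    last~inner = All.map (λ {a} a≡k → All.map (λ {b} b≢k →
                             precᵇ-flip (proj₂ a) (proj₂ b) (λ a≡b → b≢k (trans (sym a≡b) a≡k)))
                           (innerNodes-comp i λ′))
                         (lastNodes-comp i λ′)

  goodAddable-rotate : ∀ i j → resℕ e j ≡ (i ℕ.+ d) ℕ.% e →
                       ∀ λ′ → goodAddable e s j (rotate λ′) ≡ Maybe.map rotateNode (goodAddable e s i λ′)
  goodAddable-rotate i j j≡i+d λ′ = begin
    firstA (reduceRA [] (signature e s j (rotate λ′)))             ≡⟨ cong (firstA ∘ reduceRA []) (signature-rotate i j j≡i+d λ′) ⟩
    firstA (reduceRA [] (map rotateSigned (signature e s i λ′)))   ≡⟨ cong firstA (reduceRA-map rotateNode [] (signature e s i λ′)) ⟩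
    firstA (map rotateSigned (reduceRA [] (signature e s i λ′)))   ≡⟨ firstA-map rotateNode (reduceRA [] (signature e s i λ′)) ⟩
    Maybe.map rotateNode (goodAddable e s i λ′)                    ∎
    where open ≡-Reasoning

  kashiwaraF-rotate : ∀ i j → resℕ e j ≡ (i ℕ.+ d) ℕ.% e →
                      ∀ m → kashiwaraF e s j (Maybe.map rotate m) ≡ Maybe.map rotate (kashiwaraF e s i m)
  kashiwaraF-rotate i j j≡i+d nothing   = refl
  kashiwaraF-rotate i j j≡i+d (just λ′)
    rewrite goodAddable-rotate i j j≡i+d λ′ with goodAddable e s i λ′
  ... | nothing           = refl
  ... | just (node a b c) = cong just (updateAt-rotate λ′ c (setRow a b))

  applySeq-rotate : ∀ (shift : Fin e → ℕ) → (∀ i → resℕ e (shift i) ≡ (toℕ i ℕ.+ d) ℕ.% e) →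
                    ∀ {n} (is : Vec (Fin e) n) →
                    applySeq e s (Vec.map shift is) (just (emptyLP l))
                      ≡ Maybe.map rotate (applySeq e s (toRes is) (just (emptyLP l)))
  applySeq-rotate shift shift≡ Vec.[]       = cong just (sym (rotate-replicate k []))
  applySeq-rotate shift shift≡ (i Vec.∷ is) = begin
    kashiwaraF e s (shift i) (applySeq e s (Vec.map shift is) (just (emptyLP l)))
      ≡⟨ cong (kashiwaraF e s (shift i)) (applySeq-rotate shift shift≡ is) ⟩
    kashiwaraF e s (shift i) (Maybe.map rotate (applySeq e s (toRes is) (just (emptyLP l))))
      ≡⟨ kashiwaraF-rotate (toℕ i) (shift i) (shift≡ i) (applySeq e s (toRes is) (just (emptyLP l))) ⟩
    Maybe.map rotate (kashiwaraF e s (toℕ i) (applySeq e s (toRes is) (just (emptyLP l)))) ∎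
    where open ≡-Reasoning


mainTheorem2 : (l e : ℕ) → 1 ≤ l → 2 ≤ e → l ∣ e → (n : ℕ)
    → (λ′ : LPartition l) → Φ e (uglovCharge e l) n λ′
    → (is : Vec (Fin e) n)
    → applySeq e (uglovCharge e l) (toRes is) (just (emptyLP l)) ≡ just λ′
    → Φ e (uglovCharge e l) n (rotate λ′)
    × applySeq e (uglovCharge e l) (shiftSeq e l is) (just (emptyLP l)) ≡ just (rotate λ′)
-- The hypothesis λ′ ∈ Φ is implied by the given sequence is, hence unused.
mainTheorem2 (suc k) (suc e₀) (ℕ.s≤s ℕ.z≤n) (ℕ.s≤s _) l∣e n λ′ _ is is↦λ′ =
  (Vec.map shiftFin is , shifted-in-Fin) , shifted-in-ℕ
  where
  open UglovCharge k e₀ (ℕ.m/n*n≡m l∣e)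
  e = suc e₀
  d = divℕ e (suc k)
  s = uglovCharge e (suc k)

  shiftFin : Fin e → Fin e
  shiftFin i = fromℕ< (ℕ.m%n<n (toℕ i ℕ.+ d) e)

  shiftFin-residue : ∀ i → resℕ e (toℕ (shiftFin i)) ≡ (toℕ i ℕ.+ d) ℕ.% e
  shiftFin-residue i = trans (cong (ℕ._% e) (toℕ-fromℕ< (ℕ.m%n<n (toℕ i ℕ.+ d) e))) (ℕ.m%n%n≡m%n (toℕ i ℕ.+ d) e)

  shifted-in-ℕ : applySeq e s (shiftSeq e (suc k) is) (just (emptyLP (suc k))) ≡ just (rotate λ′)
  shifted-in-ℕ = trans (applySeq-rotate (λ i → toℕ i ℕ.+ d) (λ _ → refl) is) (cong (Maybe.map rotate) is↦λ′)

  shifted-in-Fin : applySeq e s (toRes (Vec.map shiftFin is)) (just (emptyLP (suc k))) ≡ just (rotate λ′)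
  shifted-in-Fin = begin
    applySeq e s (toRes (Vec.map shiftFin is)) (just (emptyLP (suc k)))   ≡⟨ cong (λ js → applySeq e s js _) (Vec.map-∘ toℕ shiftFin is) ⟨
    applySeq e s (Vec.map (toℕ ∘ shiftFin) is) (just (emptyLP (suc k)))   ≡⟨ applySeq-rotate (toℕ ∘ shiftFin) shiftFin-residue is ⟩
    Maybe.map rotate (applySeq e s (toRes is) (just (emptyLP (suc k))))   ≡⟨ cong (Maybe.map rotate) is↦λ′ ⟩
    just (rotate λ′)                                                     ∎
    where open ≡-Reasoning
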